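{- Let $\mathcal S=(n,I,J,K,\psi,\pi)$ be a system, let $k\ge2$, let $i_1<\dots<i_k$ be elements of $I$ and $j_1>\dots>j_k$ elements of $J$ with $\psi(\{i_1,\dots,i_k\})=\{j_1,\dots,j_k\}$. Define $\psi':I\to J$ by $\psi'(i_s)=j_s$ for $s=1,\dots,k$ and $\psi'=\psi$ elsewhere. If $\mathcal S'=(n,I,J,K,\psi',\pi)$ is a system, then $\mathcal S'$ improves $\mathcal S$.
   Context: A system is a tuple $\mathcal S=(n,I,J,K,\psi,\pi)$ where $n\ge2$ is an integer, $I,J,K$ are pairwise disjoint subsets of $\{2,\dots,n\}$ with $|I|=|J|\ge|K|$, $\psi:I\to J$ is a bijection, $\pi:I\to K$ is a surjection, and $i<\pi(i)<\psi(i)$ for all $i\in I$. Indices in $I$, $J$, $K$ are called exceptional, penalty and fine; other indices of $\{2,\dots,n\}$ are ordinary. For $k\in K$ put $d(k)=\min\pi^{ -1}(k)$. For $2\le r\le n$, $\theta(r)=r-2$ if $r$ is ordinary, $r-1$ if exceptional, $\psi^{ -1}(r)-1$ if penalty, $d(r)-2$ if fine. The sequence generated by $\mathcal S$ is $(y_i)_{i=0}^n$ with $y_0=1$, $y_1=2$, $y_r=y_{r-1}+y_{\theta(r)}$ ($2\le r\le n$). A system $\mathcal S'$ with the same $n$ improves $\mathcal S$ if the generated sequences satisfy $y'_n\ge y_n$. -}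

module Defs where

open import Data.Nat using (ℕ; zero; suc; _+_; _∸_; _≤_; _<_; _≥_; _≤ᵇ_; _≡ᵇ_)
open import Data.Bool using (Bool; true; false; if_then_else_; _∧_)
open import Data.Product using (Σ; ∃; _×_; _,_)
open import Data.Empty using (⊥)
open import Relation.Binary.PropositionalEquality using (_≡_)

-- Subsets of {2,…,n} are represented as Boolean predicates on ℕ;
-- the maps ψ, π : I → … are total functions ℕ → ℕ of which only the
-- values on I matter.

record System : Set where
  constructor mkSystem
  field
    n : ℕ
    I : ℕ → Bool
    J : ℕ → Bool
    K : ℕ → Bool
    ψ : ℕ → ℕ
    π : ℕ → ℕ

count : (ℕ → Bool) → ℕ → ℕ
count P zero = if P zero then 1 else 0
count P (suc m) = count P m + (if P (suc m) then 1 else 0)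

-- least i with 2 ≤ i ≤ m and P i ≡ true (0 if none)
least-from : (ℕ → Bool) → ℕ → ℕ → ℕ
least-from P i zero = 0
least-from P i (suc fuel) = if P i then i else least-from P (suc i) fuel

least : (ℕ → Bool) → ℕ → ℕ
least P m = least-from P 2 m   -- searches 2, 3, …, m+1 ⊇ {2,…,m}

record IsSystem (S : System) : Set where
  open System S
  field
    n≥2 : n ≥ 2
    I-range : ∀ r → I r ≡ true → 2 ≤ r × r ≤ n
    J-range : ∀ r → J r ≡ true → 2 ≤ r × r ≤ n
    K-range : ∀ r → K r ≡ true → 2 ≤ r × r ≤ n
    IJ-disj : ∀ r → I r ≡ true → J r ≡ true → ⊥
    IK-disj : ∀ r → I r ≡ true → K r ≡ true → ⊥
    JK-disj : ∀ r → J r ≡ true → K r ≡ true → ⊥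
    card-IJ : count I n ≡ count J n
    card-JK : count K n ≤ count J n
    ψ-into : ∀ i → I i ≡ true → J (ψ i) ≡ true
    ψ-inj : ∀ i i′ → I i ≡ true → I i′ ≡ true → ψ i ≡ ψ i′ → i ≡ i′
    ψ-onto : ∀ j → J j ≡ true → Σ ℕ λ i → I i ≡ true × ψ i ≡ j
    π-into : ∀ i → I i ≡ true → K (π i) ≡ true
    π-onto : ∀ k → K k ≡ true → Σ ℕ λ i → I i ≡ true × π i ≡ k
    order₁ : ∀ i → I i ≡ true → i < π i
    order₂ : ∀ i → I i ≡ true → π i < ψ i

module _ (S : System) where
  open System S

  -- ψ⁻¹(r): the unique i ∈ I with ψ i = r
  ψinv : ℕ → ℕ
  ψinv r = least (λ i → I i ∧ (ψ i ≡ᵇ r)) n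

  d : ℕ → ℕ
  d k = least (λ i → I i ∧ (π i ≡ᵇ k)) n

  θ : ℕ → ℕ
  θ r = if I r then r ∸ 1
        else if J r then ψinv r ∸ 1
        else if K r then d r ∸ 2
        else r ∸ 2

  -- tab m i = y_i for all i ≤ m  (m ≥ 1)
  tab : ℕ → ℕ → ℕ
  tab zero i = 1
  tab (suc zero) i = if i ≡ᵇ 0 then 1 else 2
  tab (suc (suc m)) i =
    if i ≤ᵇ suc m then tab (suc m) i
    else tab (suc m) (suc m) + tab (suc m) (θ (suc (suc m)))

  y : ℕ → ℕ
  y r = tab r r

Improves : System → System → Set
Improves S′ S = System.n S′ ≡ System.n S × y S (System.n S) ≤ y S′ (System.n S′)

-- Changing ψ into ψ′ changes the look-back map θ only at the penalty indices j, where
-- θ j = ψ⁻¹ j − 1, and ψ′ hands the larger of these values to the smaller penalty indices.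
-- Exchanging the look-back values θ p ≤ θ q of two positions p < q never decreases the
-- sequence: from p on the exchanged sequence leads by at least y (θ q) − y (θ p), which is
-- exactly what it gives back at q. Selection sort, moving the largest value to the smallest
-- unsorted position at each step, turns θ into θ′ through such exchanges.
module Submission where

open import Defs
open import Data.Bool using (Bool; true; false; if_then_else_; T; _∧_)
open import Data.Bool.Properties using (T-≡; ∧-conicalˡ; ∧-conicalʳ)
open import Data.Fin using (Fin; toℕ; fromℕ<)
open import Data.Fin.Properties using (toℕ<n; toℕ-fromℕ<; fromℕ<-toℕ)
open import Data.Nat
open import Data.Nat.Induction using (<-rec)
open import Data.Nat.Properties
open import Algebra.Properties.CommutativeSemigroup +-commutativeSemigroup using (xy∙z≈xz∙y)
open import Data.Product using (Σ; _×_; _,_; proj₁; proj₂)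
open import Data.Sum using (inj₁; inj₂)
open import Function using (id; _∘_; _⇔_; mk⇔; Equivalence)
open import Relation.Binary.Definitions using (tri<; tri≈; tri>)
open import Relation.Binary.PropositionalEquality hiding (J)
open import Relation.Nullary using (Dec; yes; no; contradiction)

-- tab for an arbitrary look-back map: the intermediate maps of the sorting argument
-- do not come from systems.
tabWith : (ℕ → ℕ) → ℕ → ℕ → ℕ
tabWith θ zero i = 1
tabWith θ (suc zero) i = if i ≡ᵇ 0 then 1 else 2
tabWith θ (suc (suc m)) i =
  if i ≤ᵇ suc m then tabWith θ (suc m) i
  else tabWith θ (suc m) (suc m) + tabWith θ (suc m) (θ (suc (suc m)))

yWith : (ℕ → ℕ) → ℕ → ℕ
yWith θ r = tabWith θ r r

tab≡tabWith : ∀ S m i → tab S m i ≡ tabWith (θ S) m i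
tab≡tabWith S zero i = refl
tab≡tabWith S (suc zero) i = refl
tab≡tabWith S (suc (suc m)) i =
  cong₂ (if i ≤ᵇ suc m then_else_) (tab≡tabWith S (suc m) i)
    (cong₂ _+_ (tab≡tabWith S (suc m) (suc m)) (tab≡tabWith S (suc m) (θ S (suc (suc m)))))

tabWith-cong : ∀ {θ θ′} → θ ≗ θ′ → ∀ m i → tabWith θ m i ≡ tabWith θ′ m i
tabWith-cong e zero i = refl
tabWith-cong e (suc zero) i = refl
tabWith-cong {θ} {θ′} e (suc (suc m)) i =
  cong₂ (if i ≤ᵇ suc m then_else_) (tabWith-cong e (suc m) i)
    (cong₂ _+_ (tabWith-cong e (suc m) (suc m))
      (trans (tabWith-cong e (suc m) (θ (suc (suc m)))) (cong (tabWith θ′ (suc m)) (e (suc (suc m))))))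

yWith-cong : ∀ {θ θ′} → θ ≗ θ′ → yWith θ ≗ yWith θ′
yWith-cong e r = tabWith-cong e r r

1+n≤ᵇn : ∀ n → (suc n ≤ᵇ n) ≡ false
1+n≤ᵇn n with suc n ≤ᵇ n in eq
... | false = refl
... | true = contradiction (≤ᵇ⇒≤ (suc n) n (subst T (sym eq) _)) (n≮n n)

yWith-unfold : ∀ θ m → yWith θ (suc (suc m)) ≡ yWith θ (suc m) + tabWith θ (suc m) (θ (suc (suc m)))
yWith-unfold θ m rewrite 1+n≤ᵇn (suc m) = refl

tabWith-extend : ∀ θ m i → tabWith θ (suc m) i ≡ yWith θ (i ⊓ suc m)
  → tabWith θ (suc (suc m)) i ≡ yWith θ (i ⊓ suc (suc m))
tabWith-extend θ m i tab≡y with i ≤ᵇ suc m in eq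
... | true =
  trans tab≡y (cong (yWith θ) (trans (m≤n⇒m⊓n≡m i≤1+m) (sym (m≤n⇒m⊓n≡m (m≤n⇒m≤1+n i≤1+m)))))
  where
  i≤1+m : i ≤ suc m
  i≤1+m = ≤ᵇ⇒≤ i (suc m) (subst T (sym eq) _)
... | false = trans (sym (yWith-unfold θ m)) (cong (yWith θ) (sym (m≥n⇒m⊓n≡n 2+m≤i)))
  where
  2+m≤i : suc (suc m) ≤ i
  2+m≤i = ≰⇒> (λ i≤1+m → subst T eq (≤⇒≤ᵇ i≤1+m))

tabWith≡yWith-⊓ : ∀ θ m i → tabWith θ m i ≡ yWith θ (i ⊓ m)
tabWith≡yWith-⊓ θ zero i rewrite ⊓-zeroʳ i = refl
tabWith≡yWith-⊓ θ (suc zero) zero = refl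
tabWith≡yWith-⊓ θ (suc zero) (suc i) rewrite ⊓-zeroʳ i = refl
tabWith≡yWith-⊓ θ (suc (suc m)) i = tabWith-extend θ m i (tabWith≡yWith-⊓ θ (suc m) i)

yWith-rec : ∀ θ m → yWith θ (suc (suc m)) ≡ yWith θ (suc m) + yWith θ (θ (suc (suc m)) ⊓ suc m)
yWith-rec θ m = trans (yWith-unfold θ m) (cong (yWith θ (suc m) +_) (tabWith≡yWith-⊓ θ (suc m) (θ (suc (suc m)))))

yWith-step : ∀ {θ m a} → θ (suc (suc m)) ≡ a → a ≤ suc m
  → yWith θ (suc (suc m)) ≡ yWith θ (suc m) + yWith θ a
yWith-step {θ} {m} refl a≤1+m =
  trans (yWith-rec θ m) (cong (λ b → yWith θ (suc m) + yWith θ b) (m≤n⇒m⊓n≡m a≤1+m))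

yWith-≤-suc : ∀ θ r → yWith θ r ≤ yWith θ (suc r)
yWith-≤-suc θ zero = s≤s z≤n
yWith-≤-suc θ (suc m) rewrite yWith-rec θ m = m≤m+n _ _

yWith-mono : ∀ θ {a b} → a ≤ b → yWith θ a ≤ yWith θ b
yWith-mono θ a≤b = go (≤⇒≤′ a≤b)
  where
  go : ∀ {a b} → a ≤′ b → yWith θ a ≤ yWith θ b
  go ≤′-refl = ≤-refl
  go {b = suc b} (≤′-step a≤′b) = ≤-trans (go a≤′b) (yWith-≤-suc θ b)

swap : ℕ → ℕ → (ℕ → ℕ) → ℕ → ℕ
swap p q θ t with t ≟ p | t ≟ q
... | yes _ | _ = θ q
... | no _ | yes _ = θ p
... | no _ | no _ = θ t

swap-at-left : ∀ p q θ → swap p q θ p ≡ θ q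
swap-at-left p q θ with p ≟ p
... | yes _ = refl
... | no p≢p = contradiction refl p≢p

swap-at-right : ∀ p q θ → swap p q θ q ≡ θ p
swap-at-right p q θ with q ≟ p | q ≟ q
... | yes refl | _ = refl
... | no _ | yes _ = refl
... | no _ | no q≢q = contradiction refl q≢q

swap-elsewhere : ∀ {p q t} θ → t ≢ p → t ≢ q → swap p q θ t ≡ θ t
swap-elsewhere {p} {q} {t} θ t≢p t≢q with t ≟ p | t ≟ q
... | yes t≡p | _ = contradiction t≡p t≢p
... | no _ | yes t≡q = contradiction t≡q t≢q
... | no _ | no _ = refl

swap-self : ∀ p θ → swap p p θ ≗ θ
swap-self p θ t with t ≟ p
... | yes refl = refl
... | no _ = refl

swap-reindex : ∀ {p q s} (θ f : ℕ → ℕ) → (f s ≡ f p → s ≡ p) → (f s ≡ f q → s ≡ q)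
  → swap (f p) (f q) θ (f s) ≡ θ (f (swap p q id s))
swap-reindex {p} {q} {s} θ f p-only q-only with s ≟ p | s ≟ q
... | yes refl | _ = swap-at-left (f s) (f q) θ
... | no _ | yes refl = swap-at-right (f p) (f s) θ
... | no s≢p | no s≢q = swap-elsewhere θ (s≢p ∘ p-only) (s≢q ∘ q-only)

module _ {θ : ℕ → ℕ} {p q : ℕ} (2≤p : 2 ≤ p) (p<q : p < q) (θp≤θq : θ p ≤ θ q) (θq<p : θ q < p) where
  private
    θ′ = swap p q θ
    α = θ p
    β = θ q
    Y = yWith θ
    Y′ = yWith θ′

  DominatedUpTo : ℕ → Set
  DominatedUpTo m = ∀ {s} → s ≤ m → Y s ≤ Y′ s

  Leads : ℕ → Set
  Leads r = p ≤ r → r < q → Y r + Y β ≤ Y′ r + Y α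

  SwapInvariant : ℕ → Set
  SwapInvariant r = Y r ≤ Y′ r × Leads r

  swapInvariant-at-p : ∀ {m} → suc (suc m) ≡ p → DominatedUpTo (suc m) → SwapInvariant (suc (suc m))
  swapInvariant-at-p {m} 2+m≡p dominated = dominates , λ _ _ → leads
    where
    β≤1+m : β ≤ suc m
    β≤1+m = ≤-pred (subst (β <_) (sym 2+m≡p) θq<p)
    Y-at-p : Y (suc (suc m)) ≡ Y (suc m) + Y α
    Y-at-p = yWith-step (cong θ 2+m≡p) (≤-trans θp≤θq β≤1+m)
    Y′-at-p : Y′ (suc (suc m)) ≡ Y′ (suc m) + Y′ β
    Y′-at-p = yWith-step (trans (cong θ′ 2+m≡p) (swap-at-left p q θ)) β≤1+m
    dominates : Y (suc (suc m)) ≤ Y′ (suc (suc m))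
    dominates rewrite Y-at-p | Y′-at-p =
      +-mono-≤ (dominated ≤-refl) (≤-trans (yWith-mono θ θp≤θq) (dominated β≤1+m))
    leads : Y (suc (suc m)) + Y β ≤ Y′ (suc (suc m)) + Y α
    leads rewrite Y-at-p | Y′-at-p | xy∙z≈xz∙y (Y (suc m)) (Y α) (Y β) =
      +-monoˡ-≤ (Y α) (+-mono-≤ (dominated ≤-refl) (dominated β≤1+m))

  swapInvariant-at-q : ∀ {m} → suc (suc m) ≡ q → DominatedUpTo (suc m) → Leads (suc m)
    → SwapInvariant (suc (suc m))
  swapInvariant-at-q {m} 2+m≡q dominated leads-before = dominates , λ _ 2+m<q → contradiction 2+m<q (<-irrefl 2+m≡q)
    where
    p≤1+m : p ≤ suc m
    p≤1+m = ≤-pred (subst (p <_) (sym 2+m≡q) p<q)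
    β≤1+m : β ≤ suc m
    β≤1+m = ≤-trans (<⇒≤ θq<p) p≤1+m
    α≤1+m : α ≤ suc m
    α≤1+m = ≤-trans θp≤θq β≤1+m
    Y-at-q : Y (suc (suc m)) ≡ Y (suc m) + Y β
    Y-at-q = yWith-step (cong θ 2+m≡q) β≤1+m
    Y′-at-q : Y′ (suc (suc m)) ≡ Y′ (suc m) + Y′ α
    Y′-at-q = yWith-step (trans (cong θ′ 2+m≡q) (swap-at-right p q θ)) α≤1+m
    dominates : Y (suc (suc m)) ≤ Y′ (suc (suc m))
    dominates rewrite Y-at-q | Y′-at-q =
      ≤-trans (leads-before p≤1+m (subst (suc m <_) 2+m≡q ≤-refl)) (+-monoʳ-≤ (Y′ (suc m)) (dominated α≤1+m))

  swapInvariant-elsewhere : ∀ {m} → suc (suc m) ≢ p → suc (suc m) ≢ q → DominatedUpTo (suc m) → Leads (suc m)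
    → SwapInvariant (suc (suc m))
  swapInvariant-elsewhere {m} 2+m≢p 2+m≢q dominated leads-before = dominates , leads
    where
    c = θ (suc (suc m)) ⊓ suc m
    Y-at : Y (suc (suc m)) ≡ Y (suc m) + Y c
    Y-at = yWith-rec θ m
    Y′-at : Y′ (suc (suc m)) ≡ Y′ (suc m) + Y′ c
    Y′-at = trans (yWith-rec θ′ m) (cong (λ a → Y′ (suc m) + Y′ (a ⊓ suc m)) (swap-elsewhere θ 2+m≢p 2+m≢q))
    Yc≤Y′c : Y c ≤ Y′ c
    Yc≤Y′c = dominated (m⊓n≤n (θ (suc (suc m))) (suc m))
    dominates : Y (suc (suc m)) ≤ Y′ (suc (suc m))
    dominates rewrite Y-at | Y′-at = +-mono-≤ (dominated ≤-refl) Yc≤Y′c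
    leads : Leads (suc (suc m))
    leads p≤2+m 2+m<q
      rewrite Y-at | Y′-at | xy∙z≈xz∙y (Y (suc m)) (Y c) (Y β) | xy∙z≈xz∙y (Y′ (suc m)) (Y′ c) (Y α) =
      +-mono-≤ (leads-before (≤-pred (≤∧≢⇒< p≤2+m (≢-sym 2+m≢p))) (<-trans ≤-refl 2+m<q)) Yc≤Y′c

  swapInvariant : ∀ r → SwapInvariant r
  swapInvariant = <-rec SwapInvariant step
    where
    step : ∀ r → (∀ {s} → s < r → SwapInvariant s) → SwapInvariant r
    step zero _ = ≤-refl , λ p≤0 _ → contradiction (≤-trans 2≤p p≤0) λ ()
    step (suc zero) _ = ≤-refl , λ p≤1 _ → contradiction (≤-trans 2≤p p≤1) (n≮n 1)
    step (suc (suc m)) ih = byPosition (suc (suc m) ≟ p) (suc (suc m) ≟ q)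
      where
      dominated : DominatedUpTo (suc m)
      dominated s≤1+m = proj₁ (ih (s≤s s≤1+m))
      byPosition : Dec (suc (suc m) ≡ p) → Dec (suc (suc m) ≡ q) → SwapInvariant (suc (suc m))
      byPosition (yes 2+m≡p) _ = swapInvariant-at-p 2+m≡p dominated
      byPosition (no _) (yes 2+m≡q) = swapInvariant-at-q 2+m≡q dominated (proj₂ (ih ≤-refl))
      byPosition (no 2+m≢p) (no 2+m≢q) = swapInvariant-elsewhere 2+m≢p 2+m≢q dominated (proj₂ (ih ≤-refl))

yWith-≤-swap : ∀ {θ p q} → 2 ≤ p → p ≤ q → θ p ≤ θ q → θ q < p
  → ∀ r → yWith θ r ≤ yWith (swap p q θ) r
yWith-≤-swap {θ} {p} 2≤p p≤q θp≤θq θq<p r with m≤n⇒m<n∨m≡n p≤q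
... | inj₁ p<q = proj₁ (swapInvariant 2≤p p<q θp≤θq θq<p r)
... | inj₂ refl = ≤-reflexive (sym (yWith-cong (swap-self p θ) r))

InjectiveBelow : ℕ → (ℕ → ℕ) → Set
InjectiveBelow k f = ∀ {s s′} → s < k → s′ < k → f s ≡ f s′ → s ≡ s′

≢-on-<⇒injectiveBelow : ∀ {k f} → (∀ {s t} → s < t → t < k → f s ≢ f t) → InjectiveBelow k f
≢-on-<⇒injectiveBelow {f = f} f≢ {s} {s′} s<k s′<k e with <-cmp s s′
... | tri< s<s′ _ _ = contradiction e (f≢ s<s′ s′<k)
... | tri≈ _ s≡s′ _ = s≡s′
... | tri> _ _ s′<s = contradiction (sym e) (f≢ s′<s s<k)

module _ {k p : ℕ} where
  swap-id-< : ∀ {s} → s < k → swap k p id s < suc k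
  swap-id-< {s} s<k with s ≟ k | s ≟ p
  ... | yes s≡k | _ = contradiction s≡k (<⇒≢ s<k)
  ... | no _ | yes _ = n<1+n k
  ... | no _ | no _ = m<n⇒m<1+n s<k

  swap-id-≢ : ∀ {s} → s < k → swap k p id s ≢ p
  swap-id-≢ {s} s<k with s ≟ k | s ≟ p
  ... | yes s≡k | _ = contradiction s≡k (<⇒≢ s<k)
  ... | no _ | yes refl = λ k≡s → <-irrefl (sym k≡s) s<k
  ... | no _ | no s≢p = s≢p

  swap-id-injectiveBelow : InjectiveBelow k (swap k p id)
  swap-id-injectiveBelow {s} {s′} s<k s′<k e with s ≟ k | s ≟ p | s′ ≟ k | s′ ≟ p
  ... | yes s≡k | _ | _ | _ = contradiction s≡k (<⇒≢ s<k)
  ... | _ | _ | yes s′≡k | _ = contradiction s′≡k (<⇒≢ s′<k)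
  ... | no _ | yes s≡p | no _ | yes s′≡p = trans s≡p (sym s′≡p)
  ... | no _ | yes _ | no _ | no _ = contradiction e (>⇒≢ s′<k)
  ... | no _ | no _ | no _ | yes _ = contradiction e (<⇒≢ s<k)
  ... | no _ | no _ | no _ | no _ = e

record IsRearrangement (k : ℕ) (a b : ℕ → ℕ) : Set where
  field
    into : ∀ {s} → s < k → Σ ℕ λ t → t < k × a s ≡ b t
    onto : ∀ {t} → t < k → Σ ℕ λ s → s < k × a s ≡ b t
    injective : InjectiveBelow k a

IsRearrangement-dropLast : ∀ {k a a′ b s₀} → IsRearrangement (suc k) a b → InjectiveBelow (suc k) b
  → s₀ < suc k → a s₀ ≡ b k → (∀ {s} → s < k → a′ s ≡ a (swap k s₀ id s))
  → IsRearrangement k a′ b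
IsRearrangement-dropLast {k} {a} {a′} {b} {s₀} R b-injective s₀<1+k as₀≡bk a′≡a∘swap =
  record { into = into′ ; onto = onto′ ; injective = injective′ }
  where
  open IsRearrangement R
  k<1+k : k < suc k
  k<1+k = n<1+n k
  below-k : ∀ {s t} → s < suc k → s ≢ s₀ → a s ≡ b t → t < suc k → t < k
  below-k s<1+k s≢s₀ as≡bt t<1+k with m<1+n⇒m<n∨m≡n t<1+k
  ... | inj₁ t<k = t<k
  ... | inj₂ refl = contradiction (injective s<1+k s₀<1+k (trans as≡bt (sym as₀≡bk))) s≢s₀
  into′ : ∀ {s} → s < k → Σ ℕ λ t → t < k × a′ s ≡ b t
  into′ s<k with into (swap-id-< s<k)
  ... | t , t<1+k , e = t , below-k (swap-id-< s<k) (swap-id-≢ s<k) e t<1+k , trans (a′≡a∘swap s<k) e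
  onto′ : ∀ {t} → t < k → Σ ℕ λ s → s < k × a′ s ≡ b t
  onto′ {t} t<k with onto (m<n⇒m<1+n t<k)
  ... | s , s<1+k , as≡bt with m<1+n⇒m<n∨m≡n s<1+k
  ...   | inj₁ s<k = s , s<k , trans (a′≡a∘swap s<k) (trans (cong a (swap-elsewhere id (<⇒≢ s<k) s≢s₀)) as≡bt)
    where
    s≢s₀ : s ≢ s₀
    s≢s₀ refl = <⇒≢ t<k (b-injective (m<n⇒m<1+n t<k) k<1+k (trans (sym as≡bt) as₀≡bk))
  ...   | inj₂ refl = s₀ , s₀<k , trans (a′≡a∘swap s₀<k) (trans (cong a (swap-at-right k s₀ id)) as≡bt)
    where
    s₀<k : s₀ < k
    s₀<k with m<1+n⇒m<n∨m≡n s₀<1+k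
    ... | inj₁ s₀<k = s₀<k
    ... | inj₂ refl = contradiction (b-injective (m<n⇒m<1+n t<k) k<1+k (trans (sym as≡bt) as₀≡bk)) (<⇒≢ t<k)
  injective′ : InjectiveBelow k a′
  injective′ s<k s′<k e =
    swap-id-injectiveBelow s<k s′<k (injective (swap-id-< s<k) (swap-id-< s′<k)
      (trans (sym (a′≡a∘swap s<k)) (trans e (a′≡a∘swap s′<k))))

record SortedRearrangement (k : ℕ) (pos val θ θ′ : ℕ → ℕ) : Set where
  field
    pos-decreasing : ∀ {s t} → s < t → t < k → pos t < pos s
    val-increasing : ∀ {s t} → s < t → t < k → val s < val t
    val<pos : ∀ {s} → s < k → val s < pos s
    2≤pos : ∀ {s} → s < k → 2 ≤ pos s
    θ′∘pos : ∀ {s} → s < k → θ′ (pos s) ≡ val s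
    θ′-elsewhere : ∀ {t} → (∀ {s} → s < k → t ≢ pos s) → θ′ t ≡ θ t
    θ∘pos-rearranges : IsRearrangement k (θ ∘ pos) val

  pos-injective : InjectiveBelow k pos
  pos-injective = ≢-on-<⇒injectiveBelow λ s<t t<k → >⇒≢ (pos-decreasing s<t t<k)

  val-injective : InjectiveBelow k val
  val-injective = ≢-on-<⇒injectiveBelow λ s<t t<k → <⇒≢ (val-increasing s<t t<k)

-- One step of selection sort: the smallest position pos k receives the largest value val k.
module SelectLast {k pos val θ θ′} (S : SortedRearrangement (suc k) pos val θ θ′) where
  open SortedRearrangement S
  open IsRearrangement θ∘pos-rearranges

  k<1+k : k < suc k
  k<1+k = n<1+n k

  s₀ : ℕ
  s₀ = proj₁ (onto k<1+k)

  s₀<1+k : s₀ < suc k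
  s₀<1+k = proj₁ (proj₂ (onto k<1+k))

  θ-at-s₀ : θ (pos s₀) ≡ val k
  θ-at-s₀ = proj₂ (proj₂ (onto k<1+k))

  θ₁ : ℕ → ℕ
  θ₁ = swap (pos k) (pos s₀) θ

  yWith-≤-θ₁ : ∀ r → yWith θ r ≤ yWith θ₁ r
  yWith-≤-θ₁ =
    yWith-≤-swap (2≤pos k<1+k) pos-k≤pos-s₀ θ-at-k≤θ-at-s₀ (subst (_< pos k) (sym θ-at-s₀) (val<pos k<1+k))
    where
    pos-k≤pos-s₀ : pos k ≤ pos s₀
    pos-k≤pos-s₀ with m<1+n⇒m<n∨m≡n s₀<1+k
    ... | inj₁ s₀<k = <⇒≤ (pos-decreasing s₀<k k<1+k)
    ... | inj₂ s₀≡k = ≤-reflexive (cong pos (sym s₀≡k))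
    θ-at-k≤θ-at-s₀ : θ (pos k) ≤ θ (pos s₀)
    θ-at-k≤θ-at-s₀ with into k<1+k
    ... | t , t<1+k , θpk≡vt with m<1+n⇒m<n∨m≡n t<1+k
    ...   | inj₁ t<k = subst₂ _≤_ (sym θpk≡vt) (sym θ-at-s₀) (<⇒≤ (val-increasing t<k k<1+k))
    ...   | inj₂ refl = ≤-reflexive (trans θpk≡vt (sym θ-at-s₀))

  θ′-elsewhere-θ₁ : ∀ {t} → (∀ {s} → s < k → t ≢ pos s) → θ′ t ≡ θ₁ t
  θ′-elsewhere-θ₁ {t} t∉pos = byPosition (t ≟ pos k)
    where
    byPosition : Dec (t ≡ pos k) → θ′ t ≡ θ₁ t
    byPosition (yes refl) = trans (θ′∘pos k<1+k) (sym (trans (swap-at-left (pos k) (pos s₀) θ) θ-at-s₀))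
    byPosition (no t≢pos-k) = trans (θ′-elsewhere t∉pos′) (sym (swap-elsewhere θ t≢pos-k (t∉pos′ s₀<1+k)))
      where
      t∉pos′ : ∀ {s} → s < suc k → t ≢ pos s
      t∉pos′ s<1+k with m<1+n⇒m<n∨m≡n s<1+k
      ... | inj₁ s<k = t∉pos s<k
      ... | inj₂ refl = t≢pos-k

  sorted-θ₁ : SortedRearrangement k pos val θ₁ θ′
  sorted-θ₁ = record
    { pos-decreasing = λ s<t t<k → pos-decreasing s<t (m<n⇒m<1+n t<k)
    ; val-increasing = λ s<t t<k → val-increasing s<t (m<n⇒m<1+n t<k)
    ; val<pos = val<pos ∘ m<n⇒m<1+n
    ; 2≤pos = 2≤pos ∘ m<n⇒m<1+n
    ; θ′∘pos = θ′∘pos ∘ m<n⇒m<1+n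
    ; θ′-elsewhere = θ′-elsewhere-θ₁
    ; θ∘pos-rearranges = IsRearrangement-dropLast θ∘pos-rearranges val-injective s₀<1+k θ-at-s₀
        λ {s} s<k → swap-reindex {k} {s₀} {s} θ pos
          (pos-injective (m<n⇒m<1+n s<k) k<1+k) (pos-injective (m<n⇒m<1+n s<k) s₀<1+k)
    }

yWith-≤-sorted : ∀ {k pos val θ θ′} → SortedRearrangement k pos val θ θ′ → ∀ r → yWith θ r ≤ yWith θ′ r
yWith-≤-sorted {zero} S r = ≤-reflexive (yWith-cong (λ t → sym (SortedRearrangement.θ′-elsewhere S {t} λ ())) r)
yWith-≤-sorted {suc k} S r = ≤-trans (yWith-≤-θ₁ r) (yWith-≤-sorted sorted-θ₁ r)
  where open SelectLast S

least-from-unique : ∀ (P : ℕ → Bool) i fuel {x} → P x ≡ true → i ≤ x → x < i + fuel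
  → (∀ {z} → P z ≡ true → z ≡ x) → least-from P i fuel ≡ x
least-from-unique P i zero Px i≤x x<i+0 unique =
  contradiction (≤-<-trans i≤x (subst (_ <_) (+-identityʳ i) x<i+0)) (<-irrefl refl)
least-from-unique P i (suc fuel) {x} Px i≤x x<i+1+fuel unique with P i in Pi
... | true = unique Pi
... | false =
  least-from-unique P (suc i) fuel Px (≤∧≢⇒< i≤x i≢x) (subst (x <_) (+-suc i fuel) x<i+1+fuel) unique
  where
  i≢x : i ≢ x
  i≢x refl = contradiction (trans (sym Pi) Px) λ ()

≡ᵇ≡true⇔≡ : ∀ {m n} → (m ≡ᵇ n) ≡ true ⇔ m ≡ n
≡ᵇ≡true⇔≡ {m} {n} = mk⇔ (≡ᵇ⇒≡ m n ∘ Equivalence.from T-≡) (Equivalence.to T-≡ ∘ ≡⇒≡ᵇ m n)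

module _ {S : System} (H : IsSystem S) where
  open System S
  open IsSystem H

  ψinv-ψ : ∀ {i} → I i ≡ true → ψinv S (ψ i) ≡ i
  ψinv-ψ {i} Ii = least-from-unique _ 2 n (cong₂ _∧_ Ii (Equivalence.from (≡ᵇ≡true⇔≡ {ψ i}) refl))
    (proj₁ (I-range i Ii)) (s≤s (m≤n⇒m≤1+n (proj₂ (I-range i Ii))))
    λ {z} Pz → ψ-inj z i (∧-conicalˡ (I z) _ Pz) Ii (Equivalence.to ≡ᵇ≡true⇔≡ (∧-conicalʳ (I z) _ Pz))

  θ-at-penalty : ∀ {j} → J j ≡ true → θ S j ≡ ψinv S j ∸ 1
  θ-at-penalty {j} Jj with I j in Ij
  ... | true = contradiction Jj (IJ-disj j Ij)
  ... | false rewrite Jj = refl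

  θ-ψ : ∀ {i} → I i ≡ true → θ S (ψ i) ≡ i ∸ 1
  θ-ψ {i} Ii = trans (θ-at-penalty (ψ-into i Ii)) (cong (_∸ 1) (ψinv-ψ Ii))

  θ-injective-on-J : ∀ {j j′} → J j ≡ true → J j′ ≡ true → θ S j ≡ θ S j′ → j ≡ j′
  θ-injective-on-J {j} {j′} Jj Jj′ θj≡θj′ with ψ-onto j Jj | ψ-onto j′ Jj′
  ... | i , Ii , refl | i′ , Ii′ , refl =
    cong ψ (∸-cancelʳ-≡ (1≤ Ii) (1≤ Ii′) (trans (sym (θ-ψ Ii)) (trans θj≡θj′ (θ-ψ Ii′))))
    where
    1≤ : ∀ {i} → I i ≡ true → 1 ≤ i
    1≤ {i} Ii = ≤-trans (s≤s z≤n) (proj₁ (I-range i Ii))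

θ-off-penalty : ∀ {n I J K ψ ψ′ π t} → J t ≡ false
  → θ (mkSystem n I J K ψ′ π) t ≡ θ (mkSystem n I J K ψ π) t
θ-off-penalty Jt rewrite Jt = refl

θ-cong-ψ : ∀ {n I J K ψ ψ′ π t} → IsSystem (mkSystem n I J K ψ π) → IsSystem (mkSystem n I J K ψ′ π)
  → (∀ {i} → I i ≡ true → ψ i ≡ t → ψ′ i ≡ t)
  → θ (mkSystem n I J K ψ′ π) t ≡ θ (mkSystem n I J K ψ π) t
θ-cong-ψ {n} {I} {J} {K} {ψ} {ψ′} {π} {t} H H′ ψ′-agrees = byPenalty (J t) refl
  where
  S = mkSystem n I J K ψ π
  S′ = mkSystem n I J K ψ′ π
  byPenalty : ∀ b → J t ≡ b → θ S′ t ≡ θ S t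
  byPenalty false Jt = θ-off-penalty {n} {I} {J} {K} {ψ} {ψ′} {π} Jt
  byPenalty true Jt with IsSystem.ψ-onto H t Jt
  ... | i , Ii , ψi≡t = trans (cong (θ S′) (sym (ψ′-agrees Ii ψi≡t)))
                          (trans (θ-ψ H′ Ii) (trans (sym (θ-ψ H Ii)) (cong (θ S) ψi≡t)))

extend : ∀ {k} → (Fin k → ℕ) → ℕ → ℕ
extend {k} f s with s <? k
... | yes s<k = f (fromℕ< s<k)
... | no _ = 0

extend-fromℕ< : ∀ {k} (f : Fin k → ℕ) {s} (s<k : s < k) → extend f s ≡ f (fromℕ< s<k)
extend-fromℕ< {k} f {s} s<k with s <? k
... | yes _ = refl
... | no s≮k = contradiction s<k s≮k

extend-toℕ : ∀ {k} (f : Fin k → ℕ) (s : Fin k) → extend f (toℕ s) ≡ f s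
extend-toℕ f s = trans (extend-fromℕ< f (toℕ<n s)) (cong f (fromℕ<-toℕ s (toℕ<n s)))

extend-monotone : ∀ {k} (_≺_ : ℕ → ℕ → Set) (f : Fin k → ℕ) → (∀ s t → toℕ s < toℕ t → f s ≺ f t)
  → ∀ {s t} → s < t → t < k → extend f s ≺ extend f t
extend-monotone {k} _≺_ f f-mono {s} {t} s<t t<k =
  subst₂ _≺_ (sym (extend-fromℕ< f s<k)) (sym (extend-fromℕ< f t<k))
    (f-mono _ _ (subst₂ _<_ (sym (toℕ-fromℕ< s<k)) (sym (toℕ-fromℕ< t<k)) s<t))
  where
  s<k : s < k
  s<k = <-trans s<t t<k

module ReorderedPenalties
  {n I J K ψ π} (H : IsSystem (mkSystem n I J K ψ π))
  {k} (is js : Fin k → ℕ) (I-is : ∀ s → I (is s) ≡ true) (J-js : ∀ s → J (js s) ≡ true)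
  (is-increasing : ∀ s t → toℕ s < toℕ t → is s < is t)
  (js-decreasing : ∀ s t → toℕ s < toℕ t → js t < js s)
  (ψ-is : ∀ s → Σ (Fin k) λ t → ψ (is s) ≡ js t)
  (ψ-is-onto : ∀ t → Σ (Fin k) λ s → ψ (is s) ≡ js t)
  {ψ′} (ψ′-is : ∀ s → ψ′ (is s) ≡ js s)
  (ψ′-elsewhere : ∀ i → I i ≡ true → (∀ s → i ≢ is s) → ψ′ i ≡ ψ i)
  (H′ : IsSystem (mkSystem n I J K ψ′ π)) where

  S = mkSystem n I J K ψ π
  S′ = mkSystem n I J K ψ′ π

  pos val : ℕ → ℕ
  pos = extend js
  -- ψ′ sends is s to js s, so θ′ (js s) = is s − 1.
  val s = extend is s ∸ 1

  pos-decreasing : ∀ {s t} → s < t → t < k → pos t < pos s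
  pos-decreasing = extend-monotone (λ a b → b < a) js js-decreasing

  I-at : ∀ {s} → s < k → I (extend is s) ≡ true
  I-at s<k = trans (cong I (extend-fromℕ< is s<k)) (I-is _)

  J-pos : ∀ {s} → s < k → J (pos s) ≡ true
  J-pos s<k = trans (cong J (extend-fromℕ< js s<k)) (J-js _)

  ψ′-at : ∀ {s} → s < k → ψ′ (extend is s) ≡ pos s
  ψ′-at s<k = trans (cong ψ′ (extend-fromℕ< is s<k)) (trans (ψ′-is _) (sym (extend-fromℕ< js s<k)))

  θ∘pos-rearranges : IsRearrangement k (θ S ∘ pos) val
  θ∘pos-rearranges = record { into = into ; onto = onto ; injective = injective }
    where
    into : ∀ {s} → s < k → Σ ℕ λ t → t < k × θ S (pos s) ≡ val t
    into s<k with ψ-is-onto (fromℕ< s<k)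
    ... | s′ , ψis′≡js = toℕ s′ , toℕ<n s′ ,
      trans (cong (θ S) (trans (extend-fromℕ< js s<k) (sym ψis′≡js)))
        (trans (θ-ψ H (I-is s′)) (cong (_∸ 1) (sym (extend-toℕ is s′))))
    onto : ∀ {t} → t < k → Σ ℕ λ s → s < k × θ S (pos s) ≡ val t
    onto t<k with ψ-is (fromℕ< t<k)
    ... | t′ , ψis≡jst′ = toℕ t′ , toℕ<n t′ ,
      trans (cong (θ S) (trans (extend-toℕ js t′) (sym ψis≡jst′)))
        (trans (θ-ψ H (I-is _)) (cong (_∸ 1) (sym (extend-fromℕ< is t<k))))
    injective : InjectiveBelow k (θ S ∘ pos)
    injective s<k s′<k e =
      ≢-on-<⇒injectiveBelow (λ s<t t<k → >⇒≢ (pos-decreasing s<t t<k)) s<k s′<k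
        (θ-injective-on-J H (J-pos s<k) (J-pos s′<k) e)

  θ′-elsewhere : ∀ {t} → (∀ {s} → s < k → t ≢ pos s) → θ S′ t ≡ θ S t
  θ′-elsewhere {t} t∉pos = θ-cong-ψ H H′ λ {i} Ii ψi≡t → trans (ψ′-elsewhere i Ii (i∉is ψi≡t)) ψi≡t
    where
    i∉is : ∀ {i} → ψ i ≡ t → ∀ s → i ≢ is s
    i∉is ψi≡t s refl with ψ-is s
    ... | s′ , ψis≡js′ = t∉pos (toℕ<n s′) (trans (sym ψi≡t) (trans ψis≡js′ (sym (extend-toℕ js s′))))

  sorted : SortedRearrangement k pos val (θ S) (θ S′)
  sorted = record
    { pos-decreasing = pos-decreasing
    ; val-increasing = λ s<t t<k →
        ∸-monoˡ-< (extend-monotone _<_ is is-increasing s<t t<k) (≤-trans (s≤s z≤n) (2≤is (<-trans s<t t<k)))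
    ; val<pos = λ s<k → ≤-<-trans (m∸n≤m _ 1) (<-trans (IsSystem.order₁ H′ _ (I-at s<k))
        (subst (π (extend is _) <_) (ψ′-at s<k) (IsSystem.order₂ H′ _ (I-at s<k))))
    ; 2≤pos = λ s<k → proj₁ (IsSystem.J-range H _ (J-pos s<k))
    ; θ′∘pos = λ s<k → trans (cong (θ S′) (sym (ψ′-at s<k))) (θ-ψ H′ (I-at s<k))
    ; θ′-elsewhere = θ′-elsewhere
    ; θ∘pos-rearranges = θ∘pos-rearranges
    }
    where
    2≤is : ∀ {s} → s < k → 2 ≤ extend is s
    2≤is s<k = proj₁ (IsSystem.I-range H _ (I-at s<k))

corollary4p10 : (n : ℕ) (I J K : ℕ → Bool) (ψ π : ℕ → ℕ)
    → IsSystem (mkSystem n I J K ψ π)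
    → (k : ℕ) → k ≥ 2
    → (is js : Fin k → ℕ)
    → (∀ s → I (is s) ≡ true) → (∀ s → J (js s) ≡ true)
    → (∀ s t → toℕ s < toℕ t → is s < is t)
    → (∀ s t → toℕ s < toℕ t → js t < js s)
    → (∀ s → Σ (Fin k) λ t → ψ (is s) ≡ js t)
    → (∀ t → Σ (Fin k) λ s → ψ (is s) ≡ js t)
    → (ψ′ : ℕ → ℕ)
    → (∀ s → ψ′ (is s) ≡ js s)
    → (∀ i → I i ≡ true → (∀ s → i ≢ is s) → ψ′ i ≡ ψ i)
    → IsSystem (mkSystem n I J K ψ′ π)
    → Improves (mkSystem n I J K ψ′ π) (mkSystem n I J K ψ π)
corollary4p10 n I J K ψ π H k _ is js I-is J-js is-increasing js-decreasing ψ-is ψ-is-onto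
              ψ′ ψ′-is ψ′-elsewhere H′ =
  refl , subst₂ _≤_ (sym (tab≡tabWith S n n)) (sym (tab≡tabWith S′ n n)) (yWith-≤-sorted sorted n)
  where
  open ReorderedPenalties H is js I-is J-js is-increasing js-decreasing ψ-is ψ-is-onto ψ′-is ψ′-elsewhere H′
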